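{- Let ParAlg be nice with traps. Let $\sigma$ be a player, $G$ a parity game, $X_1\subseteq X_2$ vertex sets, $\lambda_1\le\lambda_2$ integers, and $A$ a $\overline\sigma$-trap in $G$ with $X_1\subseteq A$. Then $\mathrm{GenAttr}(G[A],\lambda_1,X_1,\sigma,\mathrm{ParAlg})\subseteq\mathrm{GenAttr}(G,\lambda_2,X_2,\sigma,\mathrm{ParAlg})$.
   Context: A parity game $G=(V,E,p)$: finite directed graph in which every vertex has an outgoing edge, priorities $p:V\to\mathbb Z$; even-priority vertices belong to Even, odd ones to Odd; $V_\sigma$ the vertices of $\sigma$, $\overline\sigma$ the opponent, $N(v)$ the successors of $v$ in the graph under consideration. A $\sigma$-trap is a set $X$ in which every $\sigma$-vertex has all successors in $X$ and every $\overline\sigma$-vertex has some successor in $X$; $G[X]$ is the induced subgraph. ParAlg (mapping a parity game and player to a vertex subset) is nice with traps if: (i) for every parity game $G$ and $\overline\sigma$-trap $A$, $\mathrm{ParAlg}(G[A],\sigma)\subseteq\mathrm{ParAlg}(G,\sigma)$; (ii) with $S=\mathrm{ParAlg}(G,\sigma)$, for every $\overline\sigma$-trap $A\supseteq S$, $\mathrm{ParAlg}(G[A],\sigma)=S$, and for every $\sigma$-trap $A$ with $A\cap S\ne\emptyset$, $\mathrm{ParAlg}(G[A],\sigma)\ne\emptyset$; (iii) $\mathrm{ParAlg}(G,\sigma)$ is always a $\overline\sigma$-trap whose largest priority belongs to $\sigma$. $\mathrm{Attr}(G,X,\sigma)$ is the least $C\supseteq X$ containing every $v\in V_\sigma$ with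 $N(v)\cap C\ne\emptyset$ and every $v\in V_{\overline\sigma}$ with $N(v)\subseteq C$. $\mathrm{SafeAttr}(G,\lambda,X,\sigma)$ is the least $C\supseteq X$ containing every $v\in V_\sigma$ with $p(v)<\lambda$ and $N(v)\cap C\ne\emptyset$ and every $v\in V_{\overline\sigma}$ with $p(v)<\lambda$ and $N(v)\subseteq C$. $\mathrm{Restrict}(G,\lambda,\sigma)=V\setminus\mathrm{Attr}(G,\{v:p(v)\ge\lambda\},\overline\sigma)$. $\mathrm{GenAttr}(G,\lambda,X,\sigma,\mathrm{ParAlg})$: $C:=X$; repeatedly $S:=\mathrm{SafeAttr}(G,\lambda,C,\sigma)$, $V':=\mathrm{Restrict}(G[V\setminus S],\lambda,\sigma)$, $C':=S\cup\mathrm{ParAlg}(G[V'],\sigma)$; return $C'$ if $C'=C$, else $C:=C'$. -}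

module Defs where

open import Data.Nat.Base using (ℕ; zero; suc; _+_)
open import Data.Integer.Base using (ℤ; ∣_∣; _≤ᵇ_; _<_; _≤_)
open import Data.Bool.Base using (Bool; true; false; _∧_; _∨_; not; if_then_else_)
open import Data.Fin.Base using (Fin; zero; suc)
open import Data.Vec.Base using (Vec; []; _∷_; lookup; tabulate)
open import Data.List.Base using (List; []; _∷_; _++_; map; filterᵇ)
open import Data.Fin.Subset
  using (Subset; _∈_; _⊆_; _∩_; _∪_; ∁; _─_; ⋂; Nonempty; inside; outside)
open import Data.Vec.Properties using (≡-dec)
import Data.Bool.Properties as BoolP
open import Data.Product using (Σ; ∃; _×_; _,_)
open import Relation.Nullary using (¬_; does; Dec)
open import Relation.Binary.PropositionalEquality using (_≡_)

data Player : Set where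
  Even Odd : Player

opp : Player → Player
opp Even = Odd
opp Odd  = Even

_==ᴾ_ : Player → Player → Bool
Even ==ᴾ Even = true
Odd  ==ᴾ Odd  = true
_    ==ᴾ _    = false

evenᵇ : ℕ → Bool
evenᵇ zero    = true
evenᵇ (suc n) = not (evenᵇ n)

-- the player to whom a priority belongs (its parity; |z| has the parity of z)
prioOwner : ℤ → Player
prioOwner z = if evenᵇ ∣ z ∣ then Even else Odd

-- A game lives on the ambient vertex type Fin n; its vertex set is
-- the subset V, its edge relation is E restricted to V × V, and p gives the
-- priorities.  This representation makes the induced subgame G[A] a game on
-- the same ambient type, with vertex identities preserved (as in the paper).

record Game (n : ℕ) : Set where
  field
    V : Subset n
    E : Fin n → Fin n → Bool
    p : Fin n → ℤ
open Game public

_≟ˢ_ : ∀ {n} (C D : Subset n) → Dec (C ≡ D)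
_≟ˢ_ = ≡-dec BoolP._≟_

owner : ∀ {n} → Game n → Fin n → Player
owner G v = prioOwner (p G v)

Edge : ∀ {n} → Game n → Fin n → Fin n → Set
Edge G v u = u ∈ V G × E G v u ≡ true

IsParityGame : ∀ {n} → Game n → Set
IsParityGame G = ∀ {v} → v ∈ V G → ∃ λ u → Edge G v u

_[_] : ∀ {n} → Game n → Subset n → Game n
G [ A ] = record { V = V G ∩ A ; E = E G ; p = p G }

IsTrap : ∀ {n} → Game n → Player → Subset n → Set
IsTrap G σ X =
  X ⊆ V G ×
  (∀ {v} → v ∈ X → owner G v ≡ σ → ∀ {u} → Edge G v u → u ∈ X) ×
  (∀ {v} → v ∈ X → owner G v ≡ opp σ → ∃ λ u → Edge G v u × u ∈ X)

TopPriorityOf : ∀ {n} → Game n → Subset n → Player → Set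
TopPriorityOf G S σ =
  ∀ {v} → v ∈ S → (∀ {u} → u ∈ S → p G u ≤ p G v) → prioOwner (p G v) ≡ σ

anyᶠ : ∀ {n} → (Fin n → Bool) → Bool
anyᶠ {zero}  f = false
anyᶠ {suc n} f = f zero ∨ anyᶠ (λ i → f (suc i))

allᶠ : ∀ {n} → (Fin n → Bool) → Bool
allᶠ {zero}  f = true
allᶠ {suc n} f = f zero ∧ allᶠ (λ i → f (suc i))

allSubsets : ∀ n → List (Subset n)
allSubsets zero    = [] ∷ []
allSubsets (suc n) = map (inside ∷_) (allSubsets n) ++ map (outside ∷_) (allSubsets n)

-- A closure rule Φ: Φ C v = true means "v is required to be in C, given C".
-- C is closed under Φ iff every required vertex is in C.
ClosedUnder : ∀ {n} → (Subset n → Fin n → Bool) → Subset n → Bool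
ClosedUnder Φ C = allᶠ (λ v → not (Φ C v) ∨ lookup C v)

Least : ∀ {n} → (Subset n → Fin n → Bool) → Subset n
Least {n} Φ = ⋂ (filterᵇ (ClosedUnder Φ) (allSubsets n))

_==ᵖ_ : ∀ {n} → Game n → Fin n → Player → Bool
(G ==ᵖ v) σ = owner G v ==ᴾ σ

someSuccIn : ∀ {n} → Game n → Fin n → Subset n → Bool
someSuccIn G v C = anyᶠ (λ u → lookup (V G) u ∧ E G v u ∧ lookup C u)

allSuccIn : ∀ {n} → Game n → Fin n → Subset n → Bool
allSuccIn G v C = allᶠ (λ u → not (lookup (V G) u ∧ E G v u) ∨ lookup C u)

Attr : ∀ {n} → Game n → Subset n → Player → Subset n
Attr G X σ = Least λ C v →
  lookup X v ∨
  (lookup (V G) v ∧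
    (((G ==ᵖ v) σ ∧ someSuccIn G v C) ∨
     ((G ==ᵖ v) (opp σ) ∧ allSuccIn G v C)))

SafeAttr : ∀ {n} → Game n → ℤ → Subset n → Player → Subset n
SafeAttr G λ' X σ = Least λ C v →
  lookup X v ∨
  (lookup (V G) v ∧ not (λ' ≤ᵇ p G v) ∧
    (((G ==ᵖ v) σ ∧ someSuccIn G v C) ∨
     ((G ==ᵖ v) (opp σ) ∧ allSuccIn G v C)))

Restrict : ∀ {n} → Game n → ℤ → Player → Subset n
Restrict {n} G λ' σ =
  V G ─ Attr G (V G ∩ tabulate (λ v → λ' ≤ᵇ p G v)) (opp σ)

ParAlgType : Set
ParAlgType = ∀ {n} → Game n → Player → Subset n

genAttrStep : ∀ {n} → Game n → ℤ → Player → ParAlgType → Subset n → Subset n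
genAttrStep G λ' σ parAlg C =
  let S  = SafeAttr G λ' C σ
      V' = Restrict (G [ V G ─ S ]) λ' σ
  in S ∪ parAlg (G [ V' ]) σ

-- the loop: return C' if C' = C, otherwise continue with C := C'.
-- Since C ⊆ C' in every round, the loop stops after at most n+1 rounds;
-- the fuel 2 + n is therefore never exhausted.
genAttrLoop : ∀ {n} → ℕ → Game n → ℤ → Player → ParAlgType → Subset n → Subset n
genAttrLoop zero    G λ' σ parAlg C = C
genAttrLoop (suc k) G λ' σ parAlg C =
  let C' = genAttrStep G λ' σ parAlg C
  in if does (C' ≟ˢ C) then C' else genAttrLoop k G λ' σ parAlg C'

GenAttr : ∀ {n} → Game n → ℤ → Subset n → Player → ParAlgType → Subset n
GenAttr {n} G λ' X σ parAlg = genAttrLoop (2 + n) G λ' σ parAlg X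

NiceWithTraps : ParAlgType → Set
NiceWithTraps parAlg =
  (∀ {n} (G : Game n) (σ : Player) → IsParityGame G →
     (∀ (A : Subset n) → IsTrap G (opp σ) A → parAlg (G [ A ]) σ ⊆ parAlg G σ) ×
     (∀ (A : Subset n) → IsTrap G (opp σ) A → parAlg G σ ⊆ A →
        parAlg (G [ A ]) σ ≡ parAlg G σ) ×
     (∀ (A : Subset n) → IsTrap G σ A → Nonempty (A ∩ parAlg G σ) →
        Nonempty (parAlg (G [ A ]) σ)) ×
     IsTrap G (opp σ) (parAlg G σ) ×
     TopPriorityOf G (parAlg G σ) σ)

-- Let Y = GenAttr(G, λ₂, X₂).  It contains X₂ and is a fixed point of one round of the loop at
-- level λ₂, so by induction over the rounds of GenAttr(G[A], λ₁, X₁) it suffices that a round at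
-- level λ₁ in G[A] maps subsets of Y into Y.  The safe attractor of that round stays in Y, since
-- Y is closed under safe attraction at level λ₂ ≥ λ₁ and, A being a σ̄-trap, attraction in G[A]
-- is attraction in G.  For the ParAlg part P of the round let D = P ∖ Y: every σ-move from D
-- avoids Y, every σ̄-move from D that avoids Y stays in D, and every vertex of D has a move into
-- D.  Hence D is a σ-trap of the game on which P was computed and a σ̄-trap of the game on which
-- ParAlg runs in the round for G.  Both games induce the same subgame on D, so if D were
-- nonempty, niceness would put a vertex of D into the ParAlg part of the round for G, which
-- lies in Y.

module Submission where

open import Data.Bool.Base using (Bool; true; false; T; not; _∧_; _∨_; if_then_else_)
open import Data.Fin.Base using (Fin; zero; suc)
open import Data.Fin.Properties using (⊎⇔∃; ∀-cons-⇔; ¬∀⟶∃¬)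
open import Data.Fin.Subset
open import Data.Fin.Subset.Properties
open import Data.Integer.Base using (ℤ; _≤ᵇ_; _<_; _≤_)
import Data.Integer.Properties as ℤ
open import Data.List.Base using (List; []; _∷_; filterᵇ)
open import Data.List.Membership.Propositional using () renaming (_∈_ to _∈ₗ_)
open import Data.List.Membership.Propositional.Properties
  using (∈-++⁺ˡ; ∈-++⁺ʳ; ∈-map⁺; ∈-filter⁺; ∈-filter⁻)
open import Data.List.Relation.Unary.Any using (here; there)
open import Data.Nat.Base as ℕ using (ℕ; zero; suc; _+_)
import Data.Nat.Properties as ℕ
open import Data.Product using (∃; _×_; _,_; proj₁; proj₂)
open import Data.Sum using (_⊎_; inj₁; inj₂)
open import Data.Vec.Base using ([]; _∷_; lookup; tabulate; here; there)
open import Data.Vec.Properties using ([]=⇒lookup; lookup⇒[]=; lookup∘tabulate)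
open import Function.Base using (_∘_)
open import Function.Bundles using (_⇔_; mk⇔; Equivalence)
open import Relation.Binary.PropositionalEquality hiding ([_])
open import Relation.Nullary using (¬_; Dec; yes; no; does; _because_; contradiction)
open import Relation.Nullary.Decidable using (_→-dec_; T?)
open import Relation.Nullary.Reflects

open import Defs

Reflects-map : {A B : Set} {b : Bool} → A ⇔ B → Reflects A b → Reflects B b
Reflects-map A⇔B (ofʸ a)  = ofʸ (Equivalence.to A⇔B a)
Reflects-map A⇔B (ofⁿ ¬a) = ofⁿ (¬a ∘ Equivalence.from A⇔B)

reflects-sound : {A : Set} {b : Bool} → Reflects A b → T b → A
reflects-sound (ofʸ a) _ = a

reflects-complete : {A : Set} {b : Bool} → Reflects A b → A → T b
reflects-complete (ofʸ _)  _ = _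
reflects-complete (ofⁿ ¬a) a = ¬a a

≡true-reflects : ∀ b → Reflects (b ≡ true) b
≡true-reflects true  = ofʸ refl
≡true-reflects false = ofⁿ λ ()

∈-reflects : ∀ {n} (p : Subset n) x → Reflects (x ∈ p) (lookup p x)
∈-reflects p x = fromEquivalence
  (λ t → lookup⇒[]= x p (reflects-sound (≡true-reflects _) t))
  (λ x∈p → reflects-complete (≡true-reflects _) ([]=⇒lookup x∈p))

∈-tabulate-reflects : ∀ {n} (f : Fin n → Bool) v → Reflects (v ∈ tabulate f) (f v)
∈-tabulate-reflects f v = subst (Reflects _) (lookup∘tabulate f v) (∈-reflects (tabulate f) v)

anyᶠ-reflects : ∀ {n} {P : Fin n → Set} {f : Fin n → Bool} →
  (∀ i → Reflects (P i) (f i)) → Reflects (∃ P) (anyᶠ f)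
anyᶠ-reflects {zero}  r = ofⁿ λ ()
anyᶠ-reflects {suc n} r = Reflects-map ⊎⇔∃ (r zero ⊎-reflects anyᶠ-reflects (r ∘ suc))

allᶠ-reflects : ∀ {n} {P : Fin n → Set} {f : Fin n → Bool} →
  (∀ i → Reflects (P i) (f i)) → Reflects (∀ i → P i) (allᶠ f)
allᶠ-reflects {zero}  r = ofʸ λ ()
allᶠ-reflects {suc n} r = Reflects-map ∀-cons-⇔ (r zero ×-reflects allᶠ-reflects (r ∘ suc))

<-reflects : ∀ i j → Reflects (j < i) (not (i ≤ᵇ j))
<-reflects i j =
  Reflects-map (mk⇔ ℤ.≰⇒> ℤ.<⇒≱) (¬-reflects (fromEquivalence ℤ.≤ᵇ⇒≤ ℤ.≤⇒≤ᵇ))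

==ᴾ-reflects : ∀ σ τ → Reflects (σ ≡ τ) (σ ==ᴾ τ)
==ᴾ-reflects Even Even = ofʸ refl
==ᴾ-reflects Even Odd  = ofⁿ λ ()
==ᴾ-reflects Odd  Even = ofⁿ λ ()
==ᴾ-reflects Odd  Odd  = ofʸ refl

⋂-⊆ : ∀ {n} (Ds : List (Subset n)) {D} → D ∈ₗ Ds → ⋂ Ds ⊆ D
⋂-⊆ (D ∷ Ds) (here refl) = p∩q⊆p D (⋂ Ds)
⋂-⊆ (D ∷ Ds) (there D∈) = ⋂-⊆ Ds D∈ ∘ p∩q⊆q D (⋂ Ds)

∈-⋂⁺ : ∀ {n} (Ds : List (Subset n)) {x} → (∀ {D} → D ∈ₗ Ds → x ∈ D) → x ∈ ⋂ Ds
∈-⋂⁺ []       _   = ∈⊤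
∈-⋂⁺ (D ∷ Ds) x∈Ds = x∈p∩q⁺ (x∈Ds (here refl) , ∈-⋂⁺ Ds (x∈Ds ∘ there))

∈-allSubsets : ∀ {n} (D : Subset n) → D ∈ₗ allSubsets n
∈-allSubsets []          = here refl
∈-allSubsets (true ∷ D)  = ∈-++⁺ˡ (∈-map⁺ (true ∷_) (∈-allSubsets D))
∈-allSubsets (false ∷ D) = ∈-++⁺ʳ _ (∈-map⁺ (false ∷_) (∈-allSubsets D))

module _ {n} {Φ : Subset n → Fin n → Bool} {R : Subset n → Fin n → Set}
         (Φ-reflects : ∀ C v → Reflects (R C v) (Φ C v)) where

  private
    closedUnder-reflects : ∀ D → Reflects (∀ v → R D v → v ∈ D) (ClosedUnder Φ D)
    closedUnder-reflects D = allᶠ-reflects λ v → Φ-reflects D v →-reflects ∈-reflects D v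

    closedSets : List (Subset n)
    closedSets = filterᵇ (ClosedUnder Φ) (allSubsets n)

  Least-⊆ : ∀ D → (∀ v → R D v → v ∈ D) → Least Φ ⊆ D
  Least-⊆ D D-closed = ⋂-⊆ closedSets (∈-filter⁺ (T? ∘ ClosedUnder Φ) (∈-allSubsets D)
    (reflects-complete (closedUnder-reflects D) D-closed))

  Least-closed : (∀ {C D} → C ⊆ D → ∀ v → R C v → R D v) → ∀ v → R (Least Φ) v → v ∈ Least Φ
  Least-closed R-mono v r = ∈-⋂⁺ closedSets λ {D} D∈ →
    let D-closed = reflects-sound (closedUnder-reflects D)
                     (proj₂ (∈-filter⁻ (T? ∘ ClosedUnder Φ) {xs = allSubsets n} D∈))
    in D-closed v (R-mono (Least-⊆ D D-closed) v r)

edge-reflects : ∀ {n} (K : Game n) v u → Reflects (Edge K v u) (lookup (V K) u ∧ E K v u)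
edge-reflects K v u = ∈-reflects (V K) u ×-reflects ≡true-reflects (E K v u)

edge? : ∀ {n} (K : Game n) v u → Dec (Edge K v u)
edge? K v u = _ because edge-reflects K v u

data Attracts {n} (K : Game n) (σ : Player) (C : Subset n) (v : Fin n) : Set where
  by-choice : owner K v ≡ σ → ∀ {u} → Edge K v u → u ∈ C → Attracts K σ C v
  by-force  : owner K v ≡ opp σ → (∀ u → Edge K v u → u ∈ C) → Attracts K σ C v

Attracts-mono : ∀ {n} {K : Game n} {σ C D} → C ⊆ D → ∀ {v} → Attracts K σ C v → Attracts K σ D v
Attracts-mono C⊆D (by-choice o e u∈C) = by-choice o e (C⊆D u∈C)
Attracts-mono C⊆D (by-force o succ∈C) = by-force o λ u e → C⊆D (succ∈C u e)

attractsᵇ : ∀ {n} → Game n → Player → Subset n → Fin n → Bool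
attractsᵇ K σ C v = ((K ==ᵖ v) σ ∧ someSuccIn K v C) ∨ ((K ==ᵖ v) (opp σ) ∧ allSuccIn K v C)

attracts-reflects : ∀ {n} (K : Game n) σ C v → Reflects (Attracts K σ C v) (attractsᵇ K σ C v)
attracts-reflects K σ C v = Reflects-map (mk⇔ to from)
  ((==ᴾ-reflects _ σ ×-reflects anyᶠ-reflects λ u →
     ∈-reflects (V K) u ×-reflects ≡true-reflects (E K v u) ×-reflects ∈-reflects C u)
   ⊎-reflects
   (==ᴾ-reflects _ (opp σ) ×-reflects allᶠ-reflects λ u →
     edge-reflects K v u →-reflects ∈-reflects C u))
  where
  Unfolded : Set
  Unfolded = owner K v ≡ σ × (∃ λ u → u ∈ V K × E K v u ≡ true × u ∈ C) ⊎
             owner K v ≡ opp σ × (∀ u → Edge K v u → u ∈ C)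
  to : Unfolded → Attracts K σ C v
  to (inj₁ (o , u , u∈K , e , u∈C)) = by-choice o (u∈K , e) u∈C
  to (inj₂ (o , succ∈C))           = by-force o succ∈C
  from : Attracts K σ C v → Unfolded
  from (by-choice o {u} (u∈K , e) u∈C) = inj₁ (o , u , u∈K , e , u∈C)
  from (by-force o succ∈C)             = inj₂ (o , succ∈C)

module _ {n} (K : Game n) (X : Subset n) (σ : Player) where

  private
    AttrRule : Subset n → Fin n → Set
    AttrRule C v = v ∈ X ⊎ v ∈ V K × Attracts K σ C v

    attrRule-reflects : ∀ C v →
      Reflects (AttrRule C v) (lookup X v ∨ (lookup (V K) v ∧ attractsᵇ K σ C v))
    attrRule-reflects C v =
      ∈-reflects X v ⊎-reflects (∈-reflects (V K) v ×-reflects attracts-reflects K σ C v)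

    attrRule-mono : ∀ {C D} → C ⊆ D → ∀ v → AttrRule C v → AttrRule D v
    attrRule-mono C⊆D v (inj₁ v∈X)        = inj₁ v∈X
    attrRule-mono C⊆D v (inj₂ (v∈K , at)) = inj₂ (v∈K , Attracts-mono C⊆D at)

    SafeAttrRule : ℤ → Subset n → Fin n → Set
    SafeAttrRule l C v = v ∈ X ⊎ v ∈ V K × p K v < l × Attracts K σ C v

    safeAttrRule-reflects : ∀ l C v → Reflects (SafeAttrRule l C v)
      (lookup X v ∨ (lookup (V K) v ∧ not (l ≤ᵇ p K v) ∧ attractsᵇ K σ C v))
    safeAttrRule-reflects l C v = ∈-reflects X v ⊎-reflects
      (∈-reflects (V K) v ×-reflects <-reflects l (p K v) ×-reflects attracts-reflects K σ C v)

    safeAttrRule-mono : ∀ {l C D} → C ⊆ D → ∀ v → SafeAttrRule l C v → SafeAttrRule l D v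
    safeAttrRule-mono C⊆D v (inj₁ v∈X)             = inj₁ v∈X
    safeAttrRule-mono C⊆D v (inj₂ (v∈K , pv , at)) = inj₂ (v∈K , pv , Attracts-mono C⊆D at)

  X⊆Attr : X ⊆ Attr K X σ
  X⊆Attr v∈X = Least-closed attrRule-reflects attrRule-mono _ (inj₁ v∈X)

  Attr-closed : ∀ {v} → v ∈ V K → Attracts K σ (Attr K X σ) v → v ∈ Attr K X σ
  Attr-closed v∈K at = Least-closed attrRule-reflects attrRule-mono _ (inj₂ (v∈K , at))

  Attr-least : ∀ {D} → X ⊆ D → (∀ {v} → v ∈ V K → Attracts K σ D v → v ∈ D) → Attr K X σ ⊆ D
  Attr-least X⊆D D-closed = Least-⊆ attrRule-reflects _ λ where
    v (inj₁ v∈X)        → X⊆D v∈X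
    v (inj₂ (v∈K , at)) → D-closed v∈K at

  X⊆SafeAttr : ∀ l → X ⊆ SafeAttr K l X σ
  X⊆SafeAttr l v∈X = Least-closed (safeAttrRule-reflects l) safeAttrRule-mono _ (inj₁ v∈X)

  SafeAttr-closed : ∀ {l v} → v ∈ V K → p K v < l → Attracts K σ (SafeAttr K l X σ) v →
    v ∈ SafeAttr K l X σ
  SafeAttr-closed {l} v∈K pv at =
    Least-closed (safeAttrRule-reflects l) safeAttrRule-mono _ (inj₂ (v∈K , pv , at))

  SafeAttr-least : ∀ {l D} → X ⊆ D → (∀ {v} → v ∈ V K → p K v < l → Attracts K σ D v → v ∈ D) →
    SafeAttr K l X σ ⊆ D
  SafeAttr-least {l} X⊆D D-closed = Least-⊆ (safeAttrRule-reflects l) _ λ where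
    v (inj₁ v∈X)             → X⊆D v∈X
    v (inj₂ (v∈K , pv , at)) → D-closed v∈K pv at

opp-involutive : ∀ σ → opp (opp σ) ≡ σ
opp-involutive Even = refl
opp-involutive Odd  = refl

≡⊎≡opp : ∀ τ σ → τ ≡ σ ⊎ τ ≡ opp σ
≡⊎≡opp Even Even = inj₁ refl
≡⊎≡opp Even Odd  = inj₂ refl
≡⊎≡opp Odd  Even = inj₂ refl
≡⊎≡opp Odd  Odd  = inj₁ refl

x∈p─q⇒x∉q : ∀ {n} (p q : Subset n) {x} → x ∈ p ─ q → x ∉ q
x∈p─q⇒x∉q (true ∷ p) (false ∷ q) here      ()
x∈p─q⇒x∉q (_ ∷ p)    (_ ∷ q)     (there m) (there m′) = x∈p─q⇒x∉q p q m m′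

x∈p─q⁻ : ∀ {n} (p q : Subset n) {x} → x ∈ p ─ q → x ∈ p × x ∉ q
x∈p─q⁻ p q m = p─q⊆p p q m , x∈p─q⇒x∉q p q m

∃-counterexample : ∀ {n} {P Q : Fin n → Set} → (∀ i → Dec (P i)) → (∀ i → Dec (Q i)) →
  ¬ (∀ i → P i → Q i) → ∃ λ i → P i × ¬ Q i
∃-counterexample {n} P? Q? ¬P⇒Q with ¬∀⟶∃¬ n _ (λ i → P? i →-dec Q? i) ¬P⇒Q
... | i , ¬[Pi⇒Qi] with P? i
...   | yes Pi  = i , Pi , λ Qi → ¬[Pi⇒Qi] λ _ → Qi
...   | no  ¬Pi = contradiction (λ Pi → contradiction Pi ¬Pi) ¬[Pi⇒Qi]

succ∉ : ∀ {n} (K : Game n) {v C} → ¬ (∀ u → Edge K v u → u ∈ C) → ∃ λ u → Edge K v u × u ∉ C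
succ∉ K {v} {C} = ∃-counterexample (edge? K v) (_∈? C)

Edge-[]⁻ : ∀ {n} (K : Game n) W {v u} → Edge (K [ W ]) v u → Edge K v u × u ∈ W
Edge-[]⁻ K W (u∈K∩W , e) = let u∈K , u∈W = x∈p∩q⁻ (V K) W u∈K∩W in (u∈K , e) , u∈W

Edge-[]⁺ : ∀ {n} (K : Game n) {W v u} → Edge K v u → u ∈ W → Edge (K [ W ]) v u
Edge-[]⁺ K (u∈K , e) u∈W = x∈p∩q⁺ (u∈K , u∈W) , e

trap⇒isParityGame : ∀ {n} {K : Game n} {τ X} → IsParityGame K → IsTrap K τ X → IsParityGame (K [ X ])
trap⇒isParityGame {K = K} {τ} {X} K-parity (_ , all-in , some-in) {v} v∈K∩X
  with x∈p∩q⁻ (V K) X v∈K∩X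
... | v∈K , v∈X with ≡⊎≡opp (owner K v) τ
...   | inj₁ o = let u , e = K-parity v∈K in u , Edge-[]⁺ K e (all-in v∈X o e)
...   | inj₂ o = let u , e , u∈X = some-in v∈X o in u , Edge-[]⁺ K e u∈X

-- σ̄ loses no moves in the subgame on a σ̄-trap.
Attracts-[]⁻ : ∀ {n} (K : Game n) {σ A C v} → IsTrap K (opp σ) A → v ∈ A →
  Attracts (K [ A ]) σ C v → Attracts K σ C v
Attracts-[]⁻ K {A = A} _ _ (by-choice o e u∈C) = by-choice o (proj₁ (Edge-[]⁻ K A e)) u∈C
Attracts-[]⁻ K (_ , all-in , _) v∈A (by-force o succ∈C) =
  by-force o λ u e → succ∈C u (Edge-[]⁺ K e (all-in v∈A o e))

[]-≡ : ∀ {n} {K₁ K₂ : Game n} {D} → E K₁ ≡ E K₂ → p K₁ ≡ p K₂ → D ⊆ V K₁ → D ⊆ V K₂ →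
  K₁ [ D ] ≡ K₂ [ D ]
[]-≡ {K₁ = record { V = V₁ ; E = e ; p = q }} {record { V = V₂ ; E = .e ; p = .q }} {D}
  refl refl D⊆V₁ D⊆V₂ = cong (λ W → record { V = W ; E = e ; p = q })
    (trans (∩-absorbs D⊆V₁) (sym (∩-absorbs D⊆V₂)))
  where
  ∩-absorbs : ∀ {W} → D ⊆ W → W ∩ D ≡ D
  ∩-absorbs {W} D⊆W = ⊆-antisym (p∩q⊆q W D) λ x∈D → x∈p∩q⁺ (D⊆W x∈D , x∈D)

module GenAttrLoop {n} (K : Game n) (l : ℤ) (σ : Player) (pa : ParAlgType) where

  step : Subset n → Subset n
  step = genAttrStep K l σ pa

  loop : ℕ → Subset n → Subset n
  loop k = genAttrLoop k K l σ pa

  step-inflationary : ∀ C → C ⊆ step C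
  step-inflationary C = p⊆p∪q _ ∘ X⊆SafeAttr K C σ l

  loop-suc-elim : ∀ (P : Subset n → Set) k {C} →
    (step C ≡ C → P (step C)) → (step C ≢ C → P (loop k (step C))) → P (loop (suc k) C)
  loop-suc-elim P k {C} stops continues = elim (step C ≟ˢ C)
    where
    elim : (d : Dec (step C ≡ C)) → P (if does d then step C else loop k (step C))
    elim (yes fixed) = stops fixed
    elim (no  moved) = continues moved

  loop-inflationary : ∀ k C → C ⊆ loop k C
  loop-inflationary zero    C = λ x∈C → x∈C
  loop-inflationary (suc k) C = loop-suc-elim (C ⊆_) k
    (λ _ → step-inflationary C) (λ _ → loop-inflationary k (step C) ∘ step-inflationary C)

  loop-⊆ : ∀ {D} → (∀ {C} → C ⊆ D → step C ⊆ D) → ∀ k {C} → C ⊆ D → loop k C ⊆ D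
  loop-⊆ step-⊆ zero    C⊆D = C⊆D
  loop-⊆ step-⊆ (suc k) C⊆D = loop-suc-elim (_⊆ _) k
    (λ _ → step-⊆ C⊆D) (λ _ → loop-⊆ step-⊆ k (step-⊆ C⊆D))

  step-grows : ∀ {C} → step C ≢ C → ∣ C ∣ ℕ.< ∣ step C ∣
  step-grows {C} moved = p⊂q⇒∣p∣<∣q∣ (step-inflationary C ,
    ∃-counterexample (_∈? step C) (_∈? C)
      λ step⊆C → moved (⊆-antisym (λ {x} → step⊆C x) (step-inflationary C)))

  -- Every round that does not stop adds a vertex, so k + ∣ C ∣ ≥ n rounds suffice.
  loop-fixed : ∀ k C → n ℕ.≤ k + ∣ C ∣ → step (loop (suc k) C) ≡ loop (suc k) C
  loop-fixed zero C bound = loop-suc-elim (λ R → step R ≡ R) zero (cong step) λ moved →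
    contradiction bound (ℕ.<⇒≱ (ℕ.<-≤-trans (step-grows moved) (∣p∣≤n (step C))))
  loop-fixed (suc k) C bound = loop-suc-elim (λ R → step R ≡ R) (suc k) (cong step) λ moved →
    loop-fixed k (step C) (begin
      n                  ≤⟨ bound ⟩
      suc (k + ∣ C ∣)    ≡⟨ ℕ.+-suc k ∣ C ∣ ⟨
      k + suc ∣ C ∣      ≤⟨ ℕ.+-monoʳ-≤ k (step-grows moved) ⟩
      k + ∣ step C ∣     ∎)
    where open ℕ.≤-Reasoning

  GenAttr-fixed : ∀ X → step (GenAttr K l X σ pa) ≡ GenAttr K l X σ pa
  GenAttr-fixed X = loop-fixed (suc n) X (ℕ.≤-trans (ℕ.n≤1+n n) (ℕ.m≤m+n (suc n) ∣ X ∣))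

module _ {pa : ParAlgType} (nice : NiceWithTraps pa) {n} {K : Game n} {σ : Player}
         (K-parity : IsParityGame K) where

  pa-⊆ : ∀ {A} → IsTrap K (opp σ) A → pa (K [ A ]) σ ⊆ pa K σ
  pa-⊆ = proj₁ (nice K σ K-parity) _

  pa-≡ : ∀ {A} → IsTrap K (opp σ) A → pa K σ ⊆ A → pa (K [ A ]) σ ≡ pa K σ
  pa-≡ = proj₁ (proj₂ (nice K σ K-parity)) _

  pa-nonempty : ∀ {A} → IsTrap K σ A → Nonempty (A ∩ pa K σ) → Nonempty (pa (K [ A ]) σ)
  pa-nonempty = proj₁ (proj₂ (proj₂ (nice K σ K-parity))) _

  pa-isTrap : IsTrap K (opp σ) (pa K σ)
  pa-isTrap = proj₁ (proj₂ (proj₂ (proj₂ (nice K σ K-parity))))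

-- By (ii) D is a σ-trap meeting the ParAlg part of the subgame on P₁, so the shared subgame on
-- D has a nonempty ParAlg part inside D, which (i) carries into ParAlg of L₂.
shared-trap-meets-pa : ∀ {pa : ParAlgType} → NiceWithTraps pa → ∀ {n} {L₁ L₂ : Game n} {σ D} →
  IsParityGame L₁ → IsParityGame L₂ →
  IsTrap (L₁ [ pa L₁ σ ]) σ D → IsTrap L₂ (opp σ) D → (L₁ [ pa L₁ σ ]) [ D ] ≡ L₂ [ D ] →
  Nonempty D → Nonempty (D ∩ pa L₂ σ)
shared-trap-meets-pa {pa} nice {n} {L₁} {L₂} {σ} {D}
  L₁-parity L₂-parity D-σ-trap D-σ̄-trap same-subgame (w , w∈D) =
  let z , z∈pa = pa-nonempty nice L₁P₁-parity D-σ-trap (w , x∈p∩q⁺ (w∈D , w∈pa))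
  in z , x∈p∩q⁺ (∈pa⇒∈D z∈pa ,
                 pa-⊆ nice L₂-parity D-σ̄-trap (subst (λ K → z ∈ pa K σ) same-subgame z∈pa))
  where
  P₁ : Subset n
  P₁ = pa L₁ σ

  P₁-trap : IsTrap L₁ (opp σ) P₁
  P₁-trap = pa-isTrap nice L₁-parity

  L₁P₁-parity : IsParityGame (L₁ [ P₁ ])
  L₁P₁-parity = trap⇒isParityGame {K = L₁} L₁-parity P₁-trap

  w∈pa : w ∈ pa (L₁ [ P₁ ]) σ
  w∈pa = subst (w ∈_) (sym (pa-≡ nice L₁-parity P₁-trap (λ x∈P₁ → x∈P₁)))
    (proj₂ (x∈p∩q⁻ (V L₁) P₁ (proj₁ D-σ-trap w∈D)))

  ∈pa⇒∈D : ∀ {z} → z ∈ pa ((L₁ [ P₁ ]) [ D ]) σ → z ∈ D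
  ∈pa⇒∈D = proj₂ ∘ x∈p∩q⁻ (V (L₁ [ P₁ ])) D
    ∘ proj₁ (pa-isTrap nice (trap⇒isParityGame {K = L₁ [ P₁ ]} L₁P₁-parity D-σ-trap))

module Round {n} (K : Game n) (l : ℤ) (σ : Player) (pa : ParAlgType) (C : Subset n) where

  S : Subset n
  S = SafeAttr K l C σ

  K∖S : Game n
  K∖S = K [ V K ─ S ]

  High : Subset n
  High = V K∖S ∩ tabulate (λ v → l ≤ᵇ p K∖S v)

  HighAttr : Subset n
  HighAttr = Attr K∖S High (opp σ)

  V′ : Subset n
  V′ = Restrict K∖S l σ

  L : Game n
  L = K [ V′ ]

  P : Subset n
  P = pa L σ

  ∉S⇒∈K∖S : ∀ {v} → v ∈ V K → v ∉ S → v ∈ V K∖S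
  ∉S⇒∈K∖S v∈K v∉S = x∈p∩q⁺ (v∈K , x∈p∧x∉q⇒x∈p─q v∈K v∉S)

  ∈K∖S⁻ : ∀ {v} → v ∈ V K∖S → v ∈ V K × v ∉ S
  ∈K∖S⁻ v∈K∖S = let v∈K , v∈K─S = x∈p∩q⁻ (V K) (V K ─ S) v∈K∖S in v∈K , x∈p─q⇒x∉q (V K) S v∈K─S

  ∈High⇒≤ : ∀ {v} → v ∈ High → l ≤ p K v
  ∈High⇒≤ {v} v∈High =
    ℤ.≤ᵇ⇒≤ (reflects-complete (∈-tabulate-reflects _ v) (proj₂ (x∈p∩q⁻ (V K∖S) _ v∈High)))

  ∉HighAttr⇒< : ∀ {v} → v ∈ V K∖S → v ∉ HighAttr → p K v < l
  ∉HighAttr⇒< {v} v∈K∖S v∉HighAttr = ℤ.≰⇒> λ l≤pv → v∉HighAttr (X⊆Attr K∖S High (opp σ)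
    (x∈p∩q⁺ (v∈K∖S , reflects-sound (∈-tabulate-reflects _ v) (ℤ.≤⇒≤ᵇ l≤pv))))

  ∈V′⁺ : ∀ {v} → v ∈ V K∖S → v ∉ HighAttr → v ∈ V′
  ∈V′⁺ = x∈p∧x∉q⇒x∈p─q

  ∈V′⁻ : ∀ {v} → v ∈ V′ → v ∈ V K∖S × v ∉ HighAttr
  ∈V′⁻ = x∈p─q⁻ (V K∖S) HighAttr

  ∈L⇒∈V′ : ∀ {v} → v ∈ V L → v ∈ V′
  ∈L⇒∈V′ = proj₂ ∘ x∈p∩q⁻ (V K) V′

  σ̄-edge-stays : ∀ {v u} → v ∈ V′ → owner K v ≡ opp σ → Edge K v u → u ∉ S → u ∈ V′
  σ̄-edge-stays v∈V′ o e u∉S = ∈V′⁺ u∈K∖S λ u∈HighAttr → v∉HighAttr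
    (Attr-closed K∖S High (opp σ) v∈K∖S (by-choice o (u∈K∖S , proj₂ e) u∈HighAttr))
    where
    u∈K∖S = ∉S⇒∈K∖S (proj₁ e) u∉S
    v∈K∖S = proj₁ (∈V′⁻ v∈V′)
    v∉HighAttr = proj₂ (∈V′⁻ v∈V′)

  -- No hypothesis on K is needed: a vertex without moves would lie in S or in HighAttr.
  L-isParityGame : IsParityGame L
  L-isParityGame {v} v∈L with ∈V′⁻ (∈L⇒∈V′ v∈L)
  ... | v∈K∖S , v∉HighAttr with ∈K∖S⁻ v∈K∖S | ≡⊎≡opp (owner K v) σ
  ...   | _ | inj₁ o =
    let u , e , u∉HighAttr = succ∉ K∖S λ all → v∉HighAttr (Attr-closed K∖S High (opp σ) v∈K∖S
                               (by-force (trans o (sym (opp-involutive σ))) all))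
    in u , Edge-[]⁺ K (proj₁ (Edge-[]⁻ K _ e)) (∈V′⁺ (proj₁ e) u∉HighAttr)
  ...   | v∈K , v∉S | inj₂ o =
    let u , e , u∉S = succ∉ K λ all → v∉S (SafeAttr-closed K C σ v∈K
                        (∉HighAttr⇒< v∈K∖S v∉HighAttr) (by-force o all))
    in u , Edge-[]⁺ K e (σ̄-edge-stays (∈L⇒∈V′ v∈L) o e u∉S)

  module _ (nice : NiceWithTraps pa) where

    P-trap : IsTrap L (opp σ) P
    P-trap = pa-isTrap nice L-isParityGame

    ∈P⁻ : ∀ {v} → v ∈ P → v ∈ V K × p K v < l
    ∈P⁻ v∈P = let v∈K∖S , v∉HighAttr = ∈V′⁻ (∈L⇒∈V′ (proj₁ P-trap v∈P)) in
      proj₁ (∈K∖S⁻ v∈K∖S) , ∉HighAttr⇒< v∈K∖S v∉HighAttr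

    P-σ̄-succ : ∀ {v u} → v ∈ P → owner K v ≡ opp σ → Edge K v u → u ∈ S ⊎ u ∈ P
    P-σ̄-succ {v} {u} v∈P o e with u ∈? S
    ... | yes u∈S = inj₁ u∈S
    ... | no  u∉S = inj₂ (proj₁ (proj₂ P-trap) v∈P o
                      (Edge-[]⁺ K e (σ̄-edge-stays (∈L⇒∈V′ (proj₁ P-trap v∈P)) o e u∉S)))

module Comparison {pa : ParAlgType} (nice : NiceWithTraps pa) {σ : Player} {n} {G : Game n}
  {λ₁ λ₂ : ℤ} (λ₁≤λ₂ : λ₁ ≤ λ₂) {A : Subset n} (A-trap : IsTrap G (opp σ) A)
  {Y : Subset n} (Y-closed : genAttrStep G λ₂ σ pa Y ⊆ Y) where

  private
    module 𝒢 = Round G λ₂ σ pa Y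

    H : Game n
    H = G [ A ]

  S⊆Y : 𝒢.S ⊆ Y
  S⊆Y = Y-closed ∘ p⊆p∪q 𝒢.P

  P⊆Y : 𝒢.P ⊆ Y
  P⊆Y = Y-closed ∘ q⊆p∪q 𝒢.S 𝒢.P

  ∈K∖S⇒∉Y : ∀ {v} → v ∈ V 𝒢.K∖S → v ∉ Y
  ∈K∖S⇒∉Y v∈K∖S v∈Y = proj₂ (𝒢.∈K∖S⁻ v∈K∖S) (X⊆SafeAttr G Y σ λ₂ v∈Y)

  Y-attractor-closed : ∀ {v} → v ∈ V G → p G v < λ₂ → Attracts G σ Y v → v ∈ Y
  Y-attractor-closed v∈G pv at =
    S⊆Y (SafeAttr-closed G Y σ v∈G pv (Attracts-mono (X⊆SafeAttr G Y σ λ₂) at))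

  SafeAttr-⊆ : ∀ {C} → C ⊆ Y → SafeAttr H λ₁ C σ ⊆ Y
  SafeAttr-⊆ {C} C⊆Y = SafeAttr-least H C σ C⊆Y λ v∈H pv at →
    let v∈G , v∈A = x∈p∩q⁻ (V G) A v∈H in
    Y-attractor-closed v∈G (ℤ.<-≤-trans pv λ₁≤λ₂) (Attracts-[]⁻ G A-trap v∈A at)

  module _ {C} (C⊆Y : C ⊆ Y) where

    private
      module ℋ = Round H λ₁ σ pa C

      D : Subset n
      D = ℋ.P ─ Y

      ∈D⁻ : ∀ {v} → v ∈ D → v ∈ ℋ.P × v ∉ Y
      ∈D⁻ = x∈p─q⁻ ℋ.P Y

      ∈D⇒∈G : ∀ {v} → v ∈ D → v ∈ V G × p G v < λ₂
      ∈D⇒∈G v∈D = let v∈H , pv = ℋ.∈P⁻ nice (proj₁ (∈D⁻ v∈D)) in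
        proj₁ (x∈p∩q⁻ (V G) A v∈H) , ℤ.<-≤-trans pv λ₁≤λ₂

      ℋL-edge⇒G-edge : ∀ {v u} → Edge ℋ.L v u → Edge G v u
      ℋL-edge⇒G-edge = proj₁ ∘ Edge-[]⁻ G A ∘ proj₁ ∘ Edge-[]⁻ H ℋ.V′

      D-σ-edge : ∀ {v u} → v ∈ D → owner G v ≡ σ → Edge G v u → u ∉ Y
      D-σ-edge v∈D o e u∈Y = let v∈G , pv = ∈D⇒∈G v∈D in
        proj₂ (∈D⁻ v∈D) (Y-attractor-closed v∈G pv (by-choice o e u∈Y))

      D-σ-succ : ∀ {v} → v ∈ D → owner G v ≡ σ → ∃ λ u → Edge G v u × u ∈ D
      D-σ-succ v∈D o =
        let u , e , u∈P = proj₂ (proj₂ (ℋ.P-trap nice)) (proj₁ (∈D⁻ v∈D))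
                            (trans o (sym (opp-involutive σ)))
            e′ = ℋL-edge⇒G-edge e
        in u , e′ , x∈p∧x∉q⇒x∈p─q u∈P (D-σ-edge v∈D o e′)

      D-σ̄-edge : ∀ {v u} → v ∈ D → owner G v ≡ opp σ → Edge G v u → u ∉ Y → u ∈ D
      D-σ̄-edge v∈D o e u∉Y with ℋ.P-σ̄-succ nice (proj₁ (∈D⁻ v∈D)) o
                                   (Edge-[]⁺ G e (proj₁ (proj₂ A-trap) v∈A o e))
        where v∈A = proj₂ (x∈p∩q⁻ (V G) A (proj₁ (ℋ.∈P⁻ nice (proj₁ (∈D⁻ v∈D)))))
      ... | inj₁ u∈S = contradiction (SafeAttr-⊆ C⊆Y u∈S) u∉Y
      ... | inj₂ u∈P = x∈p∧x∉q⇒x∈p─q u∈P u∉Y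

      D-σ̄-succ : ∀ {v} → v ∈ D → owner G v ≡ opp σ → ∃ λ u → Edge G v u × u ∈ D
      D-σ̄-succ v∈D o =
        let v∈G , pv = ∈D⇒∈G v∈D
            u , e , u∉Y = succ∉ G λ all → proj₂ (∈D⁻ v∈D)
                             (Y-attractor-closed v∈G pv (by-force o all))
        in u , e , D-σ̄-edge v∈D o e u∉Y

      D⊆ℋL[P] : D ⊆ V (ℋ.L [ ℋ.P ])
      D⊆ℋL[P] v∈D = let v∈P = proj₁ (∈D⁻ v∈D) in x∈p∩q⁺ (proj₁ (ℋ.P-trap nice) v∈P , v∈P)

      D-σ-trap : IsTrap (ℋ.L [ ℋ.P ]) σ D
      D-σ-trap = D⊆ℋL[P] , all-in , some-in
        where
        all-in : ∀ {v} → v ∈ D → owner G v ≡ σ → ∀ {u} → Edge (ℋ.L [ ℋ.P ]) v u → u ∈ D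
        all-in v∈D o e = let e′ , u∈P = Edge-[]⁻ ℋ.L ℋ.P e in
          x∈p∧x∉q⇒x∈p─q u∈P (D-σ-edge v∈D o (ℋL-edge⇒G-edge e′))
        some-in : ∀ {v} → v ∈ D → owner G v ≡ opp σ → ∃ λ u → Edge (ℋ.L [ ℋ.P ]) v u × u ∈ D
        some-in v∈D o = let u , e , u∈D = D-σ̄-succ v∈D o in u , (D⊆ℋL[P] u∈D , proj₂ e) , u∈D

      D⊆K∖S : D ⊆ V 𝒢.K∖S
      D⊆K∖S v∈D = 𝒢.∉S⇒∈K∖S (proj₁ (∈D⇒∈G v∈D)) (proj₂ (∈D⁻ v∈D) ∘ S⊆Y)

      attracted∉D : ∀ {v} → Attracts 𝒢.K∖S (opp σ) (∁ D) v → v ∉ D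
      attracted∉D (by-choice o e u∈∁D) v∈D =
        x∈∁p⇒x∉p u∈∁D (D-σ̄-edge v∈D o (proj₁ (Edge-[]⁻ G _ e)) (∈K∖S⇒∉Y (proj₁ e)))
      attracted∉D (by-force o succ∈∁D) v∈D =
        let u , e , u∈D = D-σ-succ v∈D (trans o (opp-involutive σ)) in
        x∈∁p⇒x∉p (succ∈∁D u (D⊆K∖S u∈D , proj₂ e)) u∈D

      HighAttr⊆∁D : 𝒢.HighAttr ⊆ ∁ D
      HighAttr⊆∁D = Attr-least 𝒢.K∖S 𝒢.High (opp σ)
        (λ v∈High → x∉p⇒x∈∁p λ v∈D → ℤ.<⇒≱ (proj₂ (∈D⇒∈G v∈D)) (𝒢.∈High⇒≤ v∈High))
        (λ _ at → x∉p⇒x∈∁p (attracted∉D at))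

      D⊆𝒢L : D ⊆ V 𝒢.L
      D⊆𝒢L v∈D = x∈p∩q⁺ (proj₁ (∈D⇒∈G v∈D) ,
        𝒢.∈V′⁺ (D⊆K∖S v∈D) λ v∈HighAttr → x∈∁p⇒x∉p (HighAttr⊆∁D v∈HighAttr) v∈D)

      D-σ̄-trap : IsTrap 𝒢.L (opp σ) D
      D-σ̄-trap = D⊆𝒢L , all-in , some-in
        where
        all-in : ∀ {v} → v ∈ D → owner G v ≡ opp σ → ∀ {u} → Edge 𝒢.L v u → u ∈ D
        all-in v∈D o e = D-σ̄-edge v∈D o (proj₁ (Edge-[]⁻ G 𝒢.V′ e))
          (∈K∖S⇒∉Y (proj₁ (𝒢.∈V′⁻ (𝒢.∈L⇒∈V′ (proj₁ e)))))
        some-in : ∀ {v} → v ∈ D → owner G v ≡ opp (opp σ) → ∃ λ u → Edge 𝒢.L v u × u ∈ D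
        some-in v∈D o = let u , e , u∈D = D-σ-succ v∈D (trans o (opp-involutive σ)) in
          u , (D⊆𝒢L u∈D , proj₂ e) , u∈D

    ℋP⊆Y : ℋ.P ⊆ Y
    ℋP⊆Y {w} w∈P with w ∈? Y
    ... | yes w∈Y = w∈Y
    ... | no  w∉Y =
      let z , z∈D∩P = shared-trap-meets-pa nice ℋ.L-isParityGame 𝒢.L-isParityGame
                        D-σ-trap D-σ̄-trap ([]-≡ refl refl D⊆ℋL[P] D⊆𝒢L)
                        (w , x∈p∧x∉q⇒x∈p─q w∈P w∉Y)
          z∈D , z∈P = x∈p∩q⁻ D 𝒢.P z∈D∩P
      in contradiction (P⊆Y z∈P) (proj₂ (∈D⁻ z∈D))

  round-⊆ : ∀ {C} → C ⊆ Y → genAttrStep H λ₁ σ pa C ⊆ Y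
  round-⊆ {C} C⊆Y x∈ with x∈p∪q⁻ (SafeAttr H λ₁ C σ) (pa (Round.L H λ₁ σ pa C) σ) x∈
  ... | inj₁ x∈S = SafeAttr-⊆ C⊆Y x∈S
  ... | inj₂ x∈P = ℋP⊆Y C⊆Y x∈P

mainTheorem13 : (parAlg : ParAlgType) → NiceWithTraps parAlg →
    (σ : Player) {n : ℕ} (G : Game n) → IsParityGame G →
    (X₁ X₂ : Subset n) → X₁ ⊆ X₂ →
    (λ₁ λ₂ : ℤ) → λ₁ ≤ λ₂ →
    (A : Subset n) → IsTrap G (opp σ) A → X₁ ⊆ A →
    GenAttr (G [ A ]) λ₁ X₁ σ parAlg ⊆ GenAttr G λ₂ X₂ σ parAlg
mainTheorem13 pa nice σ {n} G _ X₁ X₂ X₁⊆X₂ λ₁ λ₂ λ₁≤λ₂ A A-trap _ =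
  GenAttrLoop.loop-⊆ (G [ A ]) λ₁ σ pa (Comparison.round-⊆ nice λ₁≤λ₂ A-trap Y-closed)
    (2 + n) (GenAttrLoop.loop-inflationary G λ₂ σ pa (2 + n) X₂ ∘ X₁⊆X₂)
  where
  Y-closed : genAttrStep G λ₂ σ pa (GenAttr G λ₂ X₂ σ pa) ⊆ GenAttr G λ₂ X₂ σ pa
  Y-closed = subst (_ ∈_) (GenAttrLoop.GenAttr-fixed G λ₂ σ pa X₂)
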